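{- Let $\mu\in\mathcal H$ with $\Re(\mu)=0$ and $m=N(\mu)$ squarefree; let $r=1$ if $m\not\equiv 3\pmod 4$, $r=2$ otherwise, and $\omega=(r-1+\mu)/r$. Let $[a,b+\omega]=R_\mu(\rho)$ be an ideal of $\mathcal O(\mu)$ with right pseudo generator $\rho$, let $\xi\in\mathcal H$ satisfy $b+\omega=\xi\rho$, and let $\omega'=\rho\omega\rho^{ -1}$. Then $(\omega,\xi)=(\omega',\xi)$.
   Context: Quaternions with Hamilton multiplication; $\Re$ real part, $N$ norm, $q^{ -1}=\overline q/N(q)$. $\mathcal H$ = Hurwitz integral quaternions $(a+bi+cj+dk)/2$, $a,b,c,d\in\mathbb Z$ of equal parity. $\mathcal O(\mu)=\mathbb Z+\mathbb Z\omega$ is a commutative subring of $\mathcal H$. For an ideal with $\mathbb Z$-basis $[a,b+\omega]$ ($a>0$), its right pseudo generator is $\rho=\gcd_r(a,b+\omega)$, a greatest-norm common right divisor in $\mathcal H$, and $R_\mu(\rho)=\{\eta\rho:\eta\in\mathcal H,\ \eta\rho\in\mathcal O(\mu)\}$. The scalar product of $q=t_0+x_0i+y_0j+z_0k$ and $s=t_1+x_1i+y_1j+z_1k$ is $(q,s)=x_0x_1+y_0y_1+z_0z_1$. -}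

module Defs where

open import Data.Nat as ℕ using (ℕ)
open import Data.Nat.Primality using (Prime)
open import Data.Integer as ℤ using (ℤ)
open import Data.Integer.Divisibility as ℤD using ()
open import Data.Rational as ℚ using (ℚ; 0ℚ; 1ℚ)
open import Data.Rational.Properties as ℚP using ()
open import Data.Product using (Σ; ∃; ∃-syntax; _×_; _,_)
open import Relation.Nullary using (¬_; yes; no)
open import Relation.Binary.PropositionalEquality using (_≡_)

record Quat : Set where
  constructor quat
  field
    re : ℚ
    qi : ℚ
    qj : ℚ
    qk : ℚ
open Quat public

infixl 6 _+Q_ _-Q_
infixl 7 _*Q_

_+Q_ : Quat → Quat → Quat
quat a b c d +Q quat a' b' c' d' =
  quat (a ℚ.+ a') (b ℚ.+ b') (c ℚ.+ c') (d ℚ.+ d')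

_-Q_ : Quat → Quat → Quat
quat a b c d -Q quat a' b' c' d' =
  quat (a ℚ.- a') (b ℚ.- b') (c ℚ.- c') (d ℚ.- d')

-- Hamilton multiplication (i² = j² = k² = ijk = -1)
_*Q_ : Quat → Quat → Quat
quat a1 b1 c1 d1 *Q quat a2 b2 c2 d2 =
  quat (a1 ℚ.* a2 ℚ.- b1 ℚ.* b2 ℚ.- c1 ℚ.* c2 ℚ.- d1 ℚ.* d2)
       (a1 ℚ.* b2 ℚ.+ b1 ℚ.* a2 ℚ.+ c1 ℚ.* d2 ℚ.- d1 ℚ.* c2)
       (a1 ℚ.* c2 ℚ.- b1 ℚ.* d2 ℚ.+ c1 ℚ.* a2 ℚ.+ d1 ℚ.* b2)
       (a1 ℚ.* d2 ℚ.+ b1 ℚ.* c2 ℚ.- c1 ℚ.* b2 ℚ.+ d1 ℚ.* a2)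

_·Q_ : ℚ → Quat → Quat
s ·Q quat a b c d = quat (s ℚ.* a) (s ℚ.* b) (s ℚ.* c) (s ℚ.* d)

ℚ→Q : ℚ → Quat
ℚ→Q s = quat s 0ℚ 0ℚ 0ℚ

ℤ→Q : ℤ → Quat
ℤ→Q n = ℚ→Q (n ℚ./ 1)

conj : Quat → Quat
conj (quat a b c d) = quat a (ℚ.- b) (ℚ.- c) (ℚ.- d)

N : Quat → ℚ
N (quat a b c d) = a ℚ.* a ℚ.+ b ℚ.* b ℚ.+ c ℚ.* c ℚ.+ d ℚ.* d

-- inverse q⁻¹ = q̄ / N(q)  (junk value 0 for q = 0, never used below)
inv : Quat → Quat
inv q with N q ℚP.≟ 0ℚ
... | yes _ = quat 0ℚ 0ℚ 0ℚ 0ℚ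
... | no n≢0 = ℚ.1/_ (N q) {{ℚ.≢-nonZero n≢0}} ·Q conj q

⟨_,_⟩ : Quat → Quat → ℚ
⟨ quat _ x0 y0 z0 , quat _ x1 y1 z1 ⟩ = x0 ℚ.* x1 ℚ.+ y0 ℚ.* y1 ℚ.+ z0 ℚ.* z1

SameParity : ℤ → ℤ → Set
SameParity a b = (ℤ.+ 2) ℤD.∣ (a ℤ.- b)

IsHurwitz : Quat → Set
IsHurwitz q = ∃[ a ] ∃[ b ] ∃[ c ] ∃[ d ]
  (SameParity a b × SameParity a c × SameParity a d ×
   q ≡ quat (a ℚ./ 2) (b ℚ./ 2) (c ℚ./ 2) (d ℚ./ 2))

RightDivides : Quat → Quat → Set
RightDivides δ q = ∃[ η ] (IsHurwitz η × q ≡ η *Q δ)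

IsRightGcd : Quat → Quat → Quat → Set
IsRightGcd ρ α β =
  IsHurwitz ρ × RightDivides ρ α × RightDivides ρ β ×
  (∀ δ → IsHurwitz δ → RightDivides δ α → RightDivides δ β → N δ ℚ.≤ N ρ)

SquareFree : ℕ → Set
SquareFree m = ∀ p → Prime p → ¬ ((p ℕ.* p) Data.Nat.Divisibility.∣ m)
  where import Data.Nat.Divisibility

r-1-of : ℕ → ℕ
r-1-of m with m ℕ.% 4 ℕ.≟ 3
... | yes _ = 1
... | no _  = 0

r-of : ℕ → ℕ
r-of m = ℕ.suc (r-1-of m)

ω-of : ℕ → Quat → Quat
ω-of m μ = (ℤ.+ 1 ℚ./ r-of m) ·Q (ℤ→Q (ℤ.+ r-1-of m) +Q μ)

InO : Quat → Quat → Set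
InO ω q = ∃[ x ] ∃[ y ] (q ≡ ℤ→Q x +Q (y ℚ./ 1) ·Q ω)

InLattice : Quat → Quat → Quat → Set
InLattice α β q = ∃[ x ] ∃[ y ] (q ≡ (x ℚ./ 1) ·Q α +Q (y ℚ./ 1) ·Q β)

IsIdealOf : Quat → Quat → Quat → Set
IsIdealOf ω α β =
  (∀ q → InLattice α β q → InO ω q) ×
  (∀ q s → InLattice α β q → InO ω s → InLattice α β (s *Q q))

InR : Quat → Quat → Quat → Set
InR ω ρ q = ∃[ η ] (IsHurwitz η × q ≡ η *Q ρ × InO ω q)

{-# OPTIONS --safe #-}
-- Write c + ω = ξρ with c rational.  Real quaternions are central and do not
-- affect the scalar product, so (ω, ξ) = (ξρ, ξ) and, since
-- ρ(ξρ)ρ̄ = N(ρ) ρξ, also (ρωρ⁻¹, ξ) = (ρξ, ξ).  Finally ξρ − ρξ = 2 ξ × ρ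
-- is orthogonal to ξ.  If N(ρ) = 0 then ρ = 0 and both sides vanish.
module Submission where

open import Defs
open import Data.Nat using (ℕ)
open import Data.Integer as ℤ using (ℤ; +_; +[1+_]; -[1+_])
open import Data.Rational as ℚ using (ℚ; 0ℚ; mkℚ)
import Data.Rational.Properties as ℚP
open import Data.List using (_∷_; [])
open import Data.Product using (_×_; _,_)
open import Relation.Nullary using (Dec; yes; no; contradiction)
open import Relation.Nullary.Decidable using (dec⇒maybe)
open import Relation.Binary.PropositionalEquality
open import Tactic.RingSolver.Core.AlmostCommutativeRing
  using (AlmostCommutativeRing; fromCommutativeRing)

ℚ-ring : AlmostCommutativeRing _ _
ℚ-ring = fromCommutativeRing ℚP.+-*-commutativeRing λ x → dec⇒maybe (0ℚ ℚP.≟ x)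

open import Tactic.RingSolver.NonReflective ℚ-ring using (solve; _⊜_; Expr; Κ; _⊕_; _⊗_; ⊝_)

-- Quaternions over formal ring expressions, mirroring the operations of Defs
-- clause by clause: the ring solver's evaluation of an identity between them
-- is then definitionally the corresponding identity between quaternions.
record Quatₑ (n : ℕ) : Set where
  constructor quatₑ
  field
    reₑ iₑ jₑ kₑ : Expr ℚ n

module _ {n : ℕ} where

  infixl 6 _+ₑ_ _⊖_
  infixl 7 _*ₑ_

  _⊖_ : Expr ℚ n → Expr ℚ n → Expr ℚ n
  x ⊖ y = x ⊕ ⊝ y

  _+ₑ_ : Quatₑ n → Quatₑ n → Quatₑ n
  quatₑ a b c d +ₑ quatₑ a' b' c' d' = quatₑ (a ⊕ a') (b ⊕ b') (c ⊕ c') (d ⊕ d')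

  _*ₑ_ : Quatₑ n → Quatₑ n → Quatₑ n
  quatₑ a1 b1 c1 d1 *ₑ quatₑ a2 b2 c2 d2 =
    quatₑ (a1 ⊗ a2 ⊖ b1 ⊗ b2 ⊖ c1 ⊗ c2 ⊖ d1 ⊗ d2)
          (a1 ⊗ b2 ⊕ b1 ⊗ a2 ⊕ c1 ⊗ d2 ⊖ d1 ⊗ c2)
          (a1 ⊗ c2 ⊖ b1 ⊗ d2 ⊕ c1 ⊗ a2 ⊕ d1 ⊗ b2)
          (a1 ⊗ d2 ⊕ b1 ⊗ c2 ⊖ c1 ⊗ b2 ⊕ d1 ⊗ a2)

  _·ₑ_ : Expr ℚ n → Quatₑ n → Quatₑ n
  s ·ₑ quatₑ a b c d = quatₑ (s ⊗ a) (s ⊗ b) (s ⊗ c) (s ⊗ d)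

  ℚ→ₑ : Expr ℚ n → Quatₑ n
  ℚ→ₑ s = quatₑ s (Κ 0ℚ) (Κ 0ℚ) (Κ 0ℚ)

  0ₑ : Quatₑ n
  0ₑ = ℚ→ₑ (Κ 0ℚ)

  conjₑ : Quatₑ n → Quatₑ n
  conjₑ (quatₑ a b c d) = quatₑ a (⊝ b) (⊝ c) (⊝ d)

  Nₑ : Quatₑ n → Expr ℚ n
  Nₑ (quatₑ a b c d) = a ⊗ a ⊕ b ⊗ b ⊕ c ⊗ c ⊕ d ⊗ d

  ⟨_,_⟩ₑ : Quatₑ n → Quatₑ n → Expr ℚ n
  ⟨ quatₑ _ x0 y0 z0 , quatₑ _ x1 y1 z1 ⟩ₑ = x0 ⊗ x1 ⊕ y0 ⊗ y1 ⊕ z0 ⊗ z1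

0Q : Quat
0Q = quat 0ℚ 0ℚ 0ℚ 0ℚ

0≤p*p : ∀ p → 0ℚ ℚ.≤ p ℚ.* p
0≤p*p p@(mkℚ (+ _) _ _)    = ℚP.nonNegative⁻¹ _ {{ℚP.nonNeg*nonNeg⇒nonNeg p p}}
-- despite its name, nonPos*nonPos⇒nonPos concludes NonNegative
0≤p*p p@(mkℚ -[1+ _ ] _ _) = ℚP.nonNegative⁻¹ _ {{ℚP.nonPos*nonPos⇒nonPos p p}}

p*p≡0⇒p≡0 : ∀ p → p ℚ.* p ≡ 0ℚ → p ≡ 0ℚ
p*p≡0⇒p≡0 p@(mkℚ (+ 0) _ _)    _     = ℚP.↥p≡0⇒p≡0 p refl
p*p≡0⇒p≡0 p@(mkℚ +[1+ _ ] _ _) p*p≡0 =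
  contradiction (subst (0ℚ ℚ.<_) p*p≡0 (ℚP.positive⁻¹ _ {{ℚP.pos*pos⇒pos p p}})) (ℚP.<-irrefl refl)
p*p≡0⇒p≡0 p@(mkℚ -[1+ _ ] _ _) p*p≡0 =
  contradiction (subst (0ℚ ℚ.<_) p*p≡0 (ℚP.positive⁻¹ _ {{ℚP.neg*neg⇒pos p p}})) (ℚP.<-irrefl refl)

p+q≡0⇒p≡0 : ∀ {p q} → 0ℚ ℚ.≤ p → 0ℚ ℚ.≤ q → p ℚ.+ q ≡ 0ℚ → p ≡ 0ℚ
p+q≡0⇒p≡0 {p} {q} 0≤p 0≤q p+q≡0 = ℚP.≤-antisym p≤0 0≤p
  where
  open ℚP.≤-Reasoning
  p≤0 : p ℚ.≤ 0ℚ
  p≤0 = begin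
    p         ≡⟨ ℚP.+-identityʳ p ⟨
    p ℚ.+ 0ℚ  ≤⟨ ℚP.+-monoʳ-≤ p 0≤q ⟩
    p ℚ.+ q   ≡⟨ p+q≡0 ⟩
    0ℚ        ∎

p+q≡0⇒p≡0×q≡0 : ∀ {p q} → 0ℚ ℚ.≤ p → 0ℚ ℚ.≤ q → p ℚ.+ q ≡ 0ℚ → p ≡ 0ℚ × q ≡ 0ℚ
p+q≡0⇒p≡0×q≡0 {p} {q} 0≤p 0≤q p+q≡0 =
  p+q≡0⇒p≡0 0≤p 0≤q p+q≡0 , p+q≡0⇒p≡0 0≤q 0≤p (trans (ℚP.+-comm q p) p+q≡0)

N≡0⇒≡0Q : ∀ q → N q ≡ 0ℚ → q ≡ 0Q
N≡0⇒≡0Q (quat a b c d) Nq≡0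
  with 0≤aa+bb ← ℚP.+-mono-≤ (0≤p*p a) (0≤p*p b)
  with aa+bb+cc≡0 , dd≡0 ← p+q≡0⇒p≡0×q≡0 (ℚP.+-mono-≤ 0≤aa+bb (0≤p*p c)) (0≤p*p d) Nq≡0
  with aa+bb≡0 , cc≡0 ← p+q≡0⇒p≡0×q≡0 0≤aa+bb (0≤p*p c) aa+bb+cc≡0
  with aa≡0 , bb≡0 ← p+q≡0⇒p≡0×q≡0 (0≤p*p a) (0≤p*p b) aa+bb≡0 =
  trans (cong₂ (λ x y → quat x y c d) (p*p≡0⇒p≡0 a aa≡0) (p*p≡0⇒p≡0 b bb≡0))
        (cong₂ (quat 0ℚ 0ℚ) (p*p≡0⇒p≡0 c cc≡0) (p*p≡0⇒p≡0 d dd≡0))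

⟨pq,p⟩≡⟨qp,p⟩ : ∀ p q → ⟨ p *Q q , p ⟩ ≡ ⟨ q *Q p , p ⟩
⟨pq,p⟩≡⟨qp,p⟩ (quat p₀ p₁ p₂ p₃) (quat q₀ q₁ q₂ q₃) =
  solve 8 (λ p₀ p₁ p₂ p₃ q₀ q₁ q₂ q₃ →
             let p = quatₑ p₀ p₁ p₂ p₃; q = quatₑ q₀ q₁ q₂ q₃ in
             ⟨ p *ₑ q , p ⟩ₑ ⊜ ⟨ q *ₑ p , p ⟩ₑ)
          refl p₀ p₁ p₂ p₃ q₀ q₁ q₂ q₃

⟨c+q,p⟩≡⟨q,p⟩ : ∀ c q p → ⟨ ℚ→Q c +Q q , p ⟩ ≡ ⟨ q , p ⟩
⟨c+q,p⟩≡⟨q,p⟩ c (quat q₀ q₁ q₂ q₃) (quat p₀ p₁ p₂ p₃) =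
  solve 9 (λ c q₀ q₁ q₂ q₃ p₀ p₁ p₂ p₃ →
             let q = quatₑ q₀ q₁ q₂ q₃; p = quatₑ p₀ p₁ p₂ p₃ in
             ⟨ ℚ→ₑ c +ₑ q , p ⟩ₑ ⊜ ⟨ q , p ⟩ₑ)
          refl c q₀ q₁ q₂ q₃ p₀ p₁ p₂ p₃

⟨r[c+q]r̄,p⟩≡⟨rqr̄,p⟩ : ∀ r c q p →
  ⟨ r *Q (ℚ→Q c +Q q) *Q conj r , p ⟩ ≡ ⟨ r *Q q *Q conj r , p ⟩
⟨r[c+q]r̄,p⟩≡⟨rqr̄,p⟩ (quat r₀ r₁ r₂ r₃) c (quat q₀ q₁ q₂ q₃) (quat p₀ p₁ p₂ p₃) =
  solve 13 (λ r₀ r₁ r₂ r₃ c q₀ q₁ q₂ q₃ p₀ p₁ p₂ p₃ →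
              let r = quatₑ r₀ r₁ r₂ r₃; q = quatₑ q₀ q₁ q₂ q₃; p = quatₑ p₀ p₁ p₂ p₃ in
              ⟨ r *ₑ (ℚ→ₑ c +ₑ q) *ₑ conjₑ r , p ⟩ₑ ⊜ ⟨ r *ₑ q *ₑ conjₑ r , p ⟩ₑ)
           refl r₀ r₁ r₂ r₃ c q₀ q₁ q₂ q₃ p₀ p₁ p₂ p₃

⟨r[qr]r̄,p⟩≡Nr*⟨rq,p⟩ : ∀ r q p → ⟨ r *Q (q *Q r) *Q conj r , p ⟩ ≡ N r ℚ.* ⟨ r *Q q , p ⟩
⟨r[qr]r̄,p⟩≡Nr*⟨rq,p⟩ (quat r₀ r₁ r₂ r₃) (quat q₀ q₁ q₂ q₃) (quat p₀ p₁ p₂ p₃) =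
  solve 12 (λ r₀ r₁ r₂ r₃ q₀ q₁ q₂ q₃ p₀ p₁ p₂ p₃ →
              let r = quatₑ r₀ r₁ r₂ r₃; q = quatₑ q₀ q₁ q₂ q₃; p = quatₑ p₀ p₁ p₂ p₃ in
              ⟨ r *ₑ (q *ₑ r) *ₑ conjₑ r , p ⟩ₑ ⊜ Nₑ r ⊗ ⟨ r *ₑ q , p ⟩ₑ)
           refl r₀ r₁ r₂ r₃ q₀ q₁ q₂ q₃ p₀ p₁ p₂ p₃

⟨q[s·r],p⟩≡s*⟨qr,p⟩ : ∀ q s r p → ⟨ q *Q (s ·Q r) , p ⟩ ≡ s ℚ.* ⟨ q *Q r , p ⟩
⟨q[s·r],p⟩≡s*⟨qr,p⟩ (quat q₀ q₁ q₂ q₃) s (quat r₀ r₁ r₂ r₃) (quat p₀ p₁ p₂ p₃) =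
  solve 13 (λ q₀ q₁ q₂ q₃ s r₀ r₁ r₂ r₃ p₀ p₁ p₂ p₃ →
              let q = quatₑ q₀ q₁ q₂ q₃; r = quatₑ r₀ r₁ r₂ r₃; p = quatₑ p₀ p₁ p₂ p₃ in
              ⟨ q *ₑ (s ·ₑ r) , p ⟩ₑ ⊜ s ⊗ ⟨ q *ₑ r , p ⟩ₑ)
           refl q₀ q₁ q₂ q₃ s r₀ r₁ r₂ r₃ p₀ p₁ p₂ p₃

⟨0qr,p⟩≡0 : ∀ q r p → ⟨ 0Q *Q q *Q r , p ⟩ ≡ 0ℚ
⟨0qr,p⟩≡0 (quat q₀ q₁ q₂ q₃) (quat r₀ r₁ r₂ r₃) (quat p₀ p₁ p₂ p₃) =
  solve 12 (λ q₀ q₁ q₂ q₃ r₀ r₁ r₂ r₃ p₀ p₁ p₂ p₃ →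
              let q = quatₑ q₀ q₁ q₂ q₃; r = quatₑ r₀ r₁ r₂ r₃; p = quatₑ p₀ p₁ p₂ p₃ in
              ⟨ 0ₑ *ₑ q *ₑ r , p ⟩ₑ ⊜ Κ 0ℚ)
           refl q₀ q₁ q₂ q₃ r₀ r₁ r₂ r₃ p₀ p₁ p₂ p₃

⟨q0,p⟩≡0 : ∀ q p → ⟨ q *Q 0Q , p ⟩ ≡ 0ℚ
⟨q0,p⟩≡0 (quat q₀ q₁ q₂ q₃) (quat p₀ p₁ p₂ p₃) =
  solve 8 (λ q₀ q₁ q₂ q₃ p₀ p₁ p₂ p₃ →
             let q = quatₑ q₀ q₁ q₂ q₃; p = quatₑ p₀ p₁ p₂ p₃ in
             ⟨ q *ₑ 0ₑ , p ⟩ₑ ⊜ Κ 0ℚ)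
          refl q₀ q₁ q₂ q₃ p₀ p₁ p₂ p₃

p⁻¹*[p*q]≡q : ∀ p .{{_ : ℚ.NonZero p}} q → ℚ.1/ p ℚ.* (p ℚ.* q) ≡ q
p⁻¹*[p*q]≡q p q = begin
  ℚ.1/ p ℚ.* (p ℚ.* q)  ≡⟨ ℚP.*-assoc (ℚ.1/ p) p q ⟨
  ℚ.1/ p ℚ.* p ℚ.* q    ≡⟨ cong (ℚ._* q) (ℚP.*-inverseˡ p) ⟩
  ℚ.1ℚ ℚ.* q            ≡⟨ ℚP.*-identityˡ q ⟩
  q                     ∎
  where open ≡-Reasoning

inv≡N⁻¹·conj : ∀ q (Nq≢0 : N q ≢ 0ℚ) → inv q ≡ (ℚ.1/ N q) {{ℚ.≢-nonZero Nq≢0}} ·Q conj q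
inv≡N⁻¹·conj q Nq≢0 with N q ℚP.≟ 0ℚ
... | yes Nq≡0 = contradiction Nq≡0 Nq≢0
... | no _     = refl

⟨ω,ξ⟩≡⟨ρωρ⁻¹,ξ⟩ : ∀ c ω ρ ξ → ℚ→Q c +Q ω ≡ ξ *Q ρ → ⟨ ω , ξ ⟩ ≡ ⟨ ρ *Q ω *Q inv ρ , ξ ⟩
⟨ω,ξ⟩≡⟨ρωρ⁻¹,ξ⟩ c ω ρ ξ c+ω≡ξρ = by-cases (N ρ ℚP.≟ 0ℚ)
  where
  open ≡-Reasoning

  ⟨ω,ξ⟩≡⟨ξρ,ξ⟩ : ⟨ ω , ξ ⟩ ≡ ⟨ ξ *Q ρ , ξ ⟩
  ⟨ω,ξ⟩≡⟨ξρ,ξ⟩ = trans (sym (⟨c+q,p⟩≡⟨q,p⟩ c ω ξ)) (cong ⟨_, ξ ⟩ c+ω≡ξρ)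

  by-cases : Dec (N ρ ≡ 0ℚ) → ⟨ ω , ξ ⟩ ≡ ⟨ ρ *Q ω *Q inv ρ , ξ ⟩
  by-cases (yes Nρ≡0) = begin
    ⟨ ω , ξ ⟩                 ≡⟨ ⟨ω,ξ⟩≡⟨ξρ,ξ⟩ ⟩
    ⟨ ξ *Q ρ , ξ ⟩            ≡⟨ cong (λ r → ⟨ ξ *Q r , ξ ⟩) ρ≡0 ⟩
    ⟨ ξ *Q 0Q , ξ ⟩           ≡⟨ ⟨q0,p⟩≡0 ξ ξ ⟩
    0ℚ                        ≡⟨ ⟨0qr,p⟩≡0 ω (inv ρ) ξ ⟨
    ⟨ 0Q *Q ω *Q inv ρ , ξ ⟩  ≡⟨ cong (λ r → ⟨ r *Q ω *Q inv ρ , ξ ⟩) ρ≡0 ⟨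
    ⟨ ρ *Q ω *Q inv ρ , ξ ⟩   ∎
    where
    ρ≡0 : ρ ≡ 0Q
    ρ≡0 = N≡0⇒≡0Q ρ Nρ≡0
  by-cases (no Nρ≢0) = begin
    ⟨ ω , ξ ⟩                                   ≡⟨ ⟨ω,ξ⟩≡⟨ξρ,ξ⟩ ⟩
    ⟨ ξ *Q ρ , ξ ⟩                              ≡⟨ ⟨pq,p⟩≡⟨qp,p⟩ ξ ρ ⟩
    ⟨ ρ *Q ξ , ξ ⟩                              ≡⟨ p⁻¹*[p*q]≡q (N ρ) _ ⟨
    s ℚ.* (N ρ ℚ.* ⟨ ρ *Q ξ , ξ ⟩)              ≡⟨ cong (s ℚ.*_) (⟨r[qr]r̄,p⟩≡Nr*⟨rq,p⟩ ρ ξ ξ) ⟨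
    s ℚ.* ⟨ ρ *Q (ξ *Q ρ) *Q conj ρ , ξ ⟩        ≡⟨ cong (λ q → s ℚ.* ⟨ ρ *Q q *Q conj ρ , ξ ⟩) c+ω≡ξρ ⟨
    s ℚ.* ⟨ ρ *Q (ℚ→Q c +Q ω) *Q conj ρ , ξ ⟩    ≡⟨ cong (s ℚ.*_) (⟨r[c+q]r̄,p⟩≡⟨rqr̄,p⟩ ρ c ω ξ) ⟩
    s ℚ.* ⟨ ρ *Q ω *Q conj ρ , ξ ⟩               ≡⟨ ⟨q[s·r],p⟩≡s*⟨qr,p⟩ (ρ *Q ω) s (conj ρ) ξ ⟨
    ⟨ ρ *Q ω *Q (s ·Q conj ρ) , ξ ⟩              ≡⟨ cong (λ r → ⟨ ρ *Q ω *Q r , ξ ⟩) (inv≡N⁻¹·conj ρ Nρ≢0) ⟨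
    ⟨ ρ *Q ω *Q inv ρ , ξ ⟩                     ∎
    where
    instance
      Nρ-nonZero : ℚ.NonZero (N ρ)
      Nρ-nonZero = ℚ.≢-nonZero Nρ≢0
    s : ℚ
    s = ℚ.1/ N ρ

proposition4 : (μ : Quat) (m : ℕ) →
    IsHurwitz μ → re μ ≡ 0ℚ → N μ ≡ (ℤ.+ m) ℚ./ 1 → SquareFree m →
    (a b : ℤ) → ℤ.+ 0 ℤ.< a → (ρ ξ : Quat) →
    IsIdealOf (ω-of m μ) (ℤ→Q a) (ℤ→Q b +Q ω-of m μ) →
    IsRightGcd ρ (ℤ→Q a) (ℤ→Q b +Q ω-of m μ) →
    (∀ q → (InLattice (ℤ→Q a) (ℤ→Q b +Q ω-of m μ) q → InR (ω-of m μ) ρ q)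
         × (InR (ω-of m μ) ρ q → InLattice (ℤ→Q a) (ℤ→Q b +Q ω-of m μ) q)) →
    IsHurwitz ξ → ℤ→Q b +Q ω-of m μ ≡ ξ *Q ρ →
    ⟨ ω-of m μ , ξ ⟩ ≡ ⟨ ρ *Q ω-of m μ *Q inv ρ , ξ ⟩
proposition4 μ m _ _ _ _ _ b _ ρ ξ _ _ _ _ b+ω≡ξρ = ⟨ω,ξ⟩≡⟨ρωρ⁻¹,ξ⟩ (b ℚ./ 1) (ω-of m μ) ρ ξ b+ω≡ξρ
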